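{- If $G$ is an even-tempered well-tempered scoring game, every option of $G$ is in $\mathcal{I}$, and $\operatorname{L}(G)\le\operatorname{R}(G)$, then $G\approx_+\operatorname{R}(G)$ and $G\approx_-\operatorname{L}(G)$ (where $\operatorname{R}(G)$ and $\operatorname{L}(G)$ are regarded as integer games).
   Context: A well-tempered scoring game is defined recursively: an even-tempered game is either an integer or a pair $\{G^L|G^R\}$ with finite nonempty sets of odd-tempered left and right options; an odd-tempered game is a pair $\{G^L|G^R\}$ with finite nonempty sets of even-tempered options. Integers have no options. $\pi(G)=0$ for even-tempered, $1$ for odd-tempered games. Subgames: $G$ and subgames of its options. Outcomes: $\operatorname{L}(n)=\operatorname{R}(n)=n$ for integers, otherwise $\operatorname{L}(G)=\max_{G^L}\operatorname{R}(G^L)$, $\operatorname{R}(G)=\min_{G^R}\operatorname{L}(G^R)$. Final outcomes: $\operatorname{Lf}(G)=\operatorname{L}(G)$, $\operatorname{Rf}(G)=\operatorname{R}(G)$ if $G$ is odd-tempered; $\operatorname{Lf}(G)=\operatorname{R}(G)$, $\operatorname{Rf}(G)=\operatorname{L}(G)$ if even-tempered. Disjunctive sum: integer sum if both are integers, else $G+H=\{G^L+H,G+H^L\mid G^R+H,G+H^R\}$. $G\approx_+H$ iff $\pi(G)=\pi(H)$ and $\operatorname{Lf}(G+X)=\operatorname{Lf}(H+X)$ for every game $X$; $G\approx_-H$ iff $\pi(G)=\pi(H)$ and $\operatorname{Rf}(G+X)=\operatorname{Rf}(H+X)$ for every game $X$. $\operatorname{gap}_0(G)$ is the supremum of $\operatorname{R}(K)-\operatorname{L}(K)$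 over even-tempered subgames $K$ of $G$; $\mathcal{I}$ is the class of games with $\operatorname{gap}_0(G)=0$. -}

module Defs where

open import Data.Integer using (ℤ; _+_; _-_; _≤_; _⊔_; _⊓_; 0ℤ)
open import Data.List using (List; []; _∷_)
open import Data.List.NonEmpty using (List⁺; _∷_; toList; _⁺++⁺_)
open import Data.List.Membership.Propositional using (_∈_)
open import Data.List.Relation.Unary.All using (All)
open import Data.Product using (Σ; _×_; ∃)
open import Relation.Binary.PropositionalEquality using (_≡_)

data Game : Set where
  int  : ℤ → Game
  node : List⁺ Game → List⁺ Game → Game

-- Parity (π): ev = even-tempered (π = 0), od = odd-tempered (π = 1).
data Par : Set where
  ev od : Par

flipP : Par → Par
flipP ev = od
flipP od = ev

_⊕_ : Par → Par → Par
ev ⊕ q = q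
od ⊕ q = flipP q

data WT : Par → Game → Set where
  wt-int  : ∀ {n} → WT ev (int n)
  wt-node : ∀ {p GL GR} → All (WT (flipP p)) (toList GL) → All (WT (flipP p)) (toList GR)
          → WT p (node GL GR)

data Option : Game → Game → Set where
  left  : ∀ {K GL GR} → K ∈ toList GL → Option K (node GL GR)
  right : ∀ {K GL GR} → K ∈ toList GR → Option K (node GL GR)

data Subgame : Game → Game → Set where
  here  : ∀ {G} → Subgame G G
  there : ∀ {K H G} → Option H G → Subgame K H → Subgame K G

mutual
  Lo : Game → ℤ
  Lo (int n) = n
  Lo (node GL GR) = maxRo GL

  Ro : Game → ℤ
  Ro (int n) = n
  Ro (node GL GR) = minLo GR

  maxRo : List⁺ Game → ℤ
  maxRo (x ∷ xs) = maxRo' (Ro x) xs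

  maxRo' : ℤ → List Game → ℤ
  maxRo' a [] = a
  maxRo' a (x ∷ xs) = maxRo' (a ⊔ Ro x) xs

  minLo : List⁺ Game → ℤ
  minLo (x ∷ xs) = minLo' (Lo x) xs

  minLo' : ℤ → List Game → ℤ
  minLo' a [] = a
  minLo' a (x ∷ xs) = minLo' (a ⊓ Lo x) xs

-- Final outcomes (parity given explicitly; for well-tempered G it is π(G))
Lf : Par → Game → ℤ
Lf od G = Lo G
Lf ev G = Ro G

Rf : Par → Game → ℤ
Rf od G = Ro G
Rf ev G = Lo G

mutual
  _⊞_ : Game → Game → Game
  int m ⊞ int n = int (m + n)
  int m ⊞ node HL HR = node (mapR (int m) HL) (mapR (int m) HR)
  node GL GR ⊞ int n = node (mapL GL (int n)) (mapL GR (int n))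
  node GL GR ⊞ node HL HR =
    node (mapL GL (node HL HR) ⁺++⁺ mapR (node GL GR) HL)
         (mapL GR (node HL HR) ⁺++⁺ mapR (node GL GR) HR)

  mapL : List⁺ Game → Game → List⁺ Game
  mapL (x ∷ xs) H = (x ⊞ H) ∷ mapL' xs H

  mapL' : List Game → Game → List Game
  mapL' [] H = []
  mapL' (x ∷ xs) H = (x ⊞ H) ∷ mapL' xs H

  mapR : Game → List⁺ Game → List⁺ Game
  mapR G (y ∷ ys) = (G ⊞ y) ∷ mapR' G ys

  mapR' : Game → List Game → List Game
  mapR' G [] = []
  mapR' G (y ∷ ys) = (G ⊞ y) ∷ mapR' G ys

_≈₊_ : Game → Game → Set
G ≈₊ H = Σ Par λ p → WT p G × WT p H ×
  (∀ q X → WT q X → Lf (p ⊕ q) (G ⊞ X) ≡ Lf (p ⊕ q) (H ⊞ X))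

_≈₋_ : Game → Game → Set
G ≈₋ H = Σ Par λ p → WT p G × WT p H ×
  (∀ q X → WT q X → Rf (p ⊕ q) (G ⊞ X) ≡ Rf (p ⊕ q) (H ⊞ X))

-- gap₀(G) = 0 : the supremum (a max over the finite, nonempty set of
-- even-tempered subgames) of R(K) - L(K) equals 0.
InI : Game → Set
InI G = (∀ K → Subgame K G → WT ev K → Ro K - Lo K ≤ 0ℤ)
      × (∃ λ K → Subgame K G × WT ev K × (Ro K - Lo K ≡ 0ℤ))

-- Write r = R(G).  Two inequalities between Lf(G + X) and r + Lf(X) are proved by
-- induction over the pair (G, X), in both parities of X at once.
-- (≥) Left answers every Right move in the G-component by a Left move there that keeps
--     R of the component at least r; this needs nothing but R(G) ≥ r.
-- (≤) Right answers every Left move G → G₁ by a best reply G₁ → G₂ in the same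
--     component.  Then L(G₂) = R(G₁) ≤ L(G) ≤ r, and since G₂ is an even-tempered
--     subgame of an option, R(G₂) ≤ L(G₂) ≤ r; so G₂ again has both outcomes at most r
--     and options with gap ≤ 0, and the induction continues.
-- The same two bounds hold for the integer game r, so Lf(G + X) = r + Lf(X) = Lf(r + X).
-- The statement for ≈₋ and L(G) is the mirror image.
module Submission where

open import Defs
open import Data.Integer using (_≤_)
open import Data.Product using (_×_)

open import Data.Integer using (ℤ; _+_; _⊔_; _⊓_)
open import Data.Integer.Properties using (≤-refl; ≤-trans; ≤-antisym; i≤i⊔j; i≤j⊔i; ⊔-sel; i⊓j≤i; i⊓j≤j; ⊓-sel; +-monoˡ-≤; +-monoʳ-≤; +-monoˡ-<; mono-<-distrib-⊔; mono-<-distrib-⊓; i-j≤0⇒i≤j; module ≤-Reasoning)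
open import Data.List using (List; []; _∷_; _++_; map)
open import Data.List.Properties using (++-identityʳ)
open import Data.List.NonEmpty using (_∷_; toList)
open import Data.List.Membership.Propositional using (_∈_)
open import Data.List.Membership.Propositional.Properties using (∈-map⁺; ∈-map⁻; ∈-++⁺ˡ; ∈-++⁺ʳ; ∈-++⁻)
open import Data.List.Relation.Unary.Any using (here; there)
open import Data.List.Relation.Unary.All as All using ()
open import Data.Product using (∃; _,_; proj₁)
open import Data.Sum using (_⊎_; inj₁; inj₂)
open import Induction.WellFounded using (Acc; acc)
open import Relation.Binary.Construct.Closure.Transitive using (TransClosure; [_]; _∷_; accessible)
open import Relation.Binary.PropositionalEquality using (_≡_; refl; sym; trans; cong; cong₂; subst)

lefts rights : Game → List Game
lefts (int _) = []
lefts (node GL _) = toList GL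
rights (int _) = []
rights (node _ GR) = toList GR

left-option : ∀ {K G} → K ∈ lefts G → Option K G
left-option {G = node _ _} m = left m

right-option : ∀ {K G} → K ∈ rights G → Option K G
right-option {G = node _ _} m = right m

WT-left : ∀ {p G K} → WT p G → K ∈ lefts G → WT (flipP p) K
WT-left (wt-node ls _) m = All.lookup ls m

WT-right : ∀ {p G K} → WT p G → K ∈ rights G → WT (flipP p) K
WT-right (wt-node _ rs) m = All.lookup rs m

data IsNode : Game → Set where
  is-node : ∀ {GL GR} → IsNode (node GL GR)

odd⇒node : ∀ {G} → WT od G → IsNode G
odd⇒node (wt-node _ _) = is-node

⊞-nodeʳ : ∀ G {H} → IsNode H → IsNode (G ⊞ H)
⊞-nodeʳ (int _) is-node = is-node
⊞-nodeʳ (node _ _) is-node = is-node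

-- Outcomes as extrema

maxRo'-init : ∀ a xs → a ≤ maxRo' a xs
maxRo'-init a [] = ≤-refl
maxRo'-init a (x ∷ xs) = ≤-trans (i≤i⊔j a (Ro x)) (maxRo'-init (a ⊔ Ro x) xs)

maxRo'-member : ∀ a xs {K} → K ∈ xs → Ro K ≤ maxRo' a xs
maxRo'-member a (x ∷ xs) (here refl) = ≤-trans (i≤j⊔i a (Ro x)) (maxRo'-init (a ⊔ Ro x) xs)
maxRo'-member a (x ∷ xs) (there m) = maxRo'-member (a ⊔ Ro x) xs m

maxRo'-attained : ∀ a xs → maxRo' a xs ≡ a ⊎ ∃ λ K → K ∈ xs × Ro K ≡ maxRo' a xs
maxRo'-attained a [] = inj₁ refl
maxRo'-attained a (x ∷ xs) with maxRo'-attained (a ⊔ Ro x) xs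
... | inj₂ (K , m , e) = inj₂ (K , there m , e)
... | inj₁ e with ⊔-sel a (Ro x)
...   | inj₁ e′ = inj₁ (trans e e′)
...   | inj₂ e′ = inj₂ (x , here refl , sym (trans e e′))

minLo'-init : ∀ a xs → minLo' a xs ≤ a
minLo'-init a [] = ≤-refl
minLo'-init a (x ∷ xs) = ≤-trans (minLo'-init (a ⊓ Lo x) xs) (i⊓j≤i a (Lo x))

minLo'-member : ∀ a xs {K} → K ∈ xs → minLo' a xs ≤ Lo K
minLo'-member a (x ∷ xs) (here refl) = ≤-trans (minLo'-init (a ⊓ Lo x) xs) (i⊓j≤j a (Lo x))
minLo'-member a (x ∷ xs) (there m) = minLo'-member (a ⊓ Lo x) xs m

minLo'-attained : ∀ a xs → minLo' a xs ≡ a ⊎ ∃ λ K → K ∈ xs × Lo K ≡ minLo' a xs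
minLo'-attained a [] = inj₁ refl
minLo'-attained a (x ∷ xs) with minLo'-attained (a ⊓ Lo x) xs
... | inj₂ (K , m , e) = inj₂ (K , there m , e)
... | inj₁ e with ⊓-sel a (Lo x)
...   | inj₁ e′ = inj₁ (trans e e′)
...   | inj₂ e′ = inj₂ (x , here refl , sym (trans e e′))

left-Ro≤Lo : ∀ {G K} → K ∈ lefts G → Ro K ≤ Lo G
left-Ro≤Lo {node (x ∷ xs) _} (here refl) = maxRo'-init (Ro x) xs
left-Ro≤Lo {node (x ∷ xs) _} (there m) = maxRo'-member (Ro x) xs m

right-Ro≤Lo : ∀ {G K} → K ∈ rights G → Ro G ≤ Lo K
right-Ro≤Lo {node _ (x ∷ xs)} (here refl) = minLo'-init (Lo x) xs
right-Ro≤Lo {node _ (x ∷ xs)} (there m) = minLo'-member (Lo x) xs m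

Lo-attained : ∀ {G} → IsNode G → ∃ λ K → K ∈ lefts G × Ro K ≡ Lo G
Lo-attained {node (x ∷ xs) _} is-node with maxRo'-attained (Ro x) xs
... | inj₁ e = x , here refl , sym e
... | inj₂ (K , m , e) = K , there m , e

Ro-attained : ∀ {G} → IsNode G → ∃ λ K → K ∈ rights G × Lo K ≡ Ro G
Ro-attained {node _ (x ∷ xs)} is-node with minLo'-attained (Lo x) xs
... | inj₁ e = x , here refl , sym e
... | inj₂ (K , m , e) = K , there m , e

Lo-least : ∀ {G c} → IsNode G → (∀ {K} → K ∈ lefts G → Ro K ≤ c) → Lo G ≤ c
Lo-least n bound with Lo-attained n
... | _ , m , e = subst (_≤ _) e (bound m)

Ro-greatest : ∀ {G c} → IsNode G → (∀ {K} → K ∈ rights G → c ≤ Lo K) → c ≤ Ro G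
Ro-greatest n bound with Ro-attained n
... | _ , m , e = subst (_ ≤_) e (bound m)

mutual
  Lo-⊞-int : ∀ G n → Lo (G ⊞ int n) ≡ Lo G + n
  Lo-⊞-int (int m) n = refl
  Lo-⊞-int (node (x ∷ xs) _) n = maxRo'-shift (Ro-⊞-int x n) xs

  Ro-⊞-int : ∀ G n → Ro (G ⊞ int n) ≡ Ro G + n
  Ro-⊞-int (int m) n = refl
  Ro-⊞-int (node _ (x ∷ xs)) n = minLo'-shift (Lo-⊞-int x n) xs

  maxRo'-shift : ∀ {a b n} → b ≡ a + n → ∀ xs → maxRo' b (mapL' xs (int n)) ≡ maxRo' a xs + n
  maxRo'-shift e [] = e
  maxRo'-shift {a} {n = n} e (x ∷ xs) = maxRo'-shift
    (trans (cong₂ _⊔_ e (Ro-⊞-int x n)) (sym (mono-<-distrib-⊔ (_+ n) (+-monoˡ-< n) a (Ro x)))) xs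

  minLo'-shift : ∀ {a b n} → b ≡ a + n → ∀ xs → minLo' b (mapL' xs (int n)) ≡ minLo' a xs + n
  minLo'-shift e [] = e
  minLo'-shift {a} {n = n} e (x ∷ xs) = minLo'-shift
    (trans (cong₂ _⊓_ e (Lo-⊞-int x n)) (sym (mono-<-distrib-⊓ (_+ n) (+-monoˡ-< n) a (Lo x)))) xs

-- Options of a sum

mapL'≡map : ∀ xs H → mapL' xs H ≡ map (_⊞ H) xs
mapL'≡map [] H = refl
mapL'≡map (x ∷ xs) H = cong (x ⊞ H ∷_) (mapL'≡map xs H)

mapR'≡map : ∀ G ys → mapR' G ys ≡ map (G ⊞_) ys
mapR'≡map G [] = refl
mapR'≡map G (y ∷ ys) = cong (G ⊞ y ∷_) (mapR'≡map G ys)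

toList-mapL : ∀ xs H → toList (mapL xs H) ≡ map (_⊞ H) (toList xs)
toList-mapL (x ∷ xs) H = cong (x ⊞ H ∷_) (mapL'≡map xs H)

toList-mapR : ∀ G ys → toList (mapR G ys) ≡ map (G ⊞_) (toList ys)
toList-mapR G (y ∷ ys) = cong (G ⊞ y ∷_) (mapR'≡map G ys)

record SplitsOverSums (options : Game → List Game) : Set where
  field
    split : ∀ G H → options (G ⊞ H) ≡ map (_⊞ H) (options G) ++ map (G ⊞_) (options H)

lefts-⊞ : SplitsOverSums lefts
lefts-⊞ = record { split = split }
  where
  split : ∀ G H → lefts (G ⊞ H) ≡ map (_⊞ H) (lefts G) ++ map (G ⊞_) (lefts H)
  split (int m) (int n) = refl
  split (int m) (node HL _) = toList-mapR (int m) HL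
  split (node GL _) (int n) = trans (toList-mapL GL (int n)) (sym (++-identityʳ _))
  split (node GL _) (node HL _) = cong₂ _++_ (toList-mapL GL _) (toList-mapR _ HL)

rights-⊞ : SplitsOverSums rights
rights-⊞ = record { split = split }
  where
  split : ∀ G H → rights (G ⊞ H) ≡ map (_⊞ H) (rights G) ++ map (G ⊞_) (rights H)
  split (int m) (int n) = refl
  split (int m) (node _ HR) = toList-mapR (int m) HR
  split (node _ GR) (int n) = trans (toList-mapL GR (int n)) (sym (++-identityʳ _))
  split (node _ GR) (node _ HR) = cong₂ _++_ (toList-mapL GR _) (toList-mapR _ HR)

data SumOption (options : Game → List Game) (G H : Game) : Game → Set where
  inˡ : ∀ {K} → K ∈ options G → SumOption options G H (K ⊞ H)
  inʳ : ∀ {K} → K ∈ options H → SumOption options G H (G ⊞ K)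

module _ {options : Game → List Game} (splits : SplitsOverSums options) where

  open SplitsOverSums splits

  ∈-⊞⁺ : ∀ G H {K} → SumOption options G H K → K ∈ options (G ⊞ H)
  ∈-⊞⁺ G H (inˡ m) = subst (_ ∈_) (sym (split G H)) (∈-++⁺ˡ (∈-map⁺ (_⊞ H) m))
  ∈-⊞⁺ G H (inʳ m) = subst (_ ∈_) (sym (split G H)) (∈-++⁺ʳ _ (∈-map⁺ (G ⊞_) m))

  ∈-⊞⁻ : ∀ G H {K} → K ∈ options (G ⊞ H) → SumOption options G H K
  ∈-⊞⁻ G H k with ∈-++⁻ (map (_⊞ H) (options G)) (subst (_ ∈_) (split G H) k)
  ... | inj₁ k′ with ∈-map⁻ (_⊞ H) k′
  ...   | _ , m , refl = inˡ m
  ∈-⊞⁻ G H k | inj₂ k′ with ∈-map⁻ (G ⊞_) k′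
  ...   | _ , m , refl = inʳ m

-- Proper subgames are well founded

_⊏_ : Game → Game → Set
_⊏_ = TransClosure Option

mutual
  option-acc : ∀ G → Acc Option G
  option-acc (int n) = acc λ ()
  option-acc (node (x ∷ xs) (y ∷ ys)) = acc λ where
    (left m) → member-acc x xs m
    (right m) → member-acc y ys m

  member-acc : ∀ x xs {K} → K ∈ x ∷ xs → Acc Option K
  member-acc x xs (here refl) = option-acc x
  member-acc x (x′ ∷ xs) (there m) = member-acc x′ xs m

⊏-acc : ∀ G → Acc _⊏_ G
⊏-acc G = accessible Option (option-acc G)

-- The half gap₀ ≤ 0 of "every option is in 𝓘".
OptionGaps≤0 : Game → Set
OptionGaps≤0 G = ∀ {K S} → Option K G → Subgame S K → WT ev S → Ro S ≤ Lo S

option-option-gaps : ∀ {G K K′} → OptionGaps≤0 G → Option K G → Option K′ K → OptionGaps≤0 K′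
option-option-gaps gaps o o′ o″ s = gaps o (there o′ (there o″ s))

record Capped (r : ℤ) (K : Game) : Set where
  field
    even : WT ev K
    Lo≤  : Lo K ≤ r
    Ro≤  : Ro K ≤ r
    gaps : OptionGaps≤0 K

record Floored (l : ℤ) (K : Game) : Set where
  field
    even : WT ev K
    ≤Lo  : l ≤ Lo K
    ≤Ro  : l ≤ Ro K
    gaps : OptionGaps≤0 K

capped-reply : ∀ {r K K₁ K₂} → Capped r K → K₁ ∈ lefts K → K₂ ∈ rights K₁ → Lo K₂ ≤ r
             → Capped r K₂
capped-reply {K₂ = K₂} c m m₂ Lo≤r = record
  { even = even₂
  ; Lo≤  = Lo≤r
  ; Ro≤  = ≤-trans (gaps (left-option m) (there (right-option m₂) here) even₂) Lo≤r
  ; gaps = option-option-gaps gaps (left-option m) (right-option m₂)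
  }
  where
  open Capped c
  even₂ : WT ev K₂
  even₂ = WT-right (WT-left even m) m₂

floored-reply : ∀ {l K K₁ K₂} → Floored l K → K₁ ∈ rights K → K₂ ∈ lefts K₁ → l ≤ Ro K₂
              → Floored l K₂
floored-reply {K₂ = K₂} f m m₂ l≤Ro = record
  { even = even₂
  ; ≤Lo  = ≤-trans l≤Ro (gaps (right-option m) (there (left-option m₂) here) even₂)
  ; ≤Ro  = l≤Ro
  ; gaps = option-option-gaps gaps (right-option m) (left-option m₂)
  }
  where
  open Floored f
  even₂ : WT ev K₂
  even₂ = WT-left (WT-right even m) m₂

-- Bounds on Lf(K + X)

module _ {r : ℤ} where
  open ≤-Reasoning

  mutual
    Ro-⊞-capped : ∀ {K X} → Acc _⊏_ K → Acc _⊏_ X → Capped r K → WT ev X → Ro (K ⊞ X) ≤ r + Ro X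
    Ro-⊞-capped {K} {int x} _ _ c _ = begin
      Ro (K ⊞ int x) ≡⟨ Ro-⊞-int K x ⟩
      Ro K + x       ≤⟨ +-monoˡ-≤ x (Capped.Ro≤ c) ⟩
      r + x          ∎
    Ro-⊞-capped {K} {X@(node _ _)} accK (acc rsX) c wX with Ro-attained {X} is-node
    ... | X₁ , m , e = begin
      Ro (K ⊞ X)  ≤⟨ right-Ro≤Lo (∈-⊞⁺ rights-⊞ K X (inʳ m)) ⟩
      Lo (K ⊞ X₁) ≤⟨ Lo-⊞-capped accK (rsX [ right-option m ]) c (WT-right wX m) ⟩
      r + Lo X₁   ≡⟨ cong (r +_) e ⟩
      r + Ro X    ∎

    Lo-⊞-capped : ∀ {K X} → Acc _⊏_ K → Acc _⊏_ X → Capped r K → WT od X → Lo (K ⊞ X) ≤ r + Lo X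
    Lo-⊞-capped {K} {X} (acc rsK) (acc rsX) c wX = Lo-least (⊞-nodeʳ K (odd⇒node wX)) bound
      where
      open Capped c
      bound : ∀ {O} → O ∈ lefts (K ⊞ X) → Ro O ≤ r + Lo X
      bound o with ∈-⊞⁻ lefts-⊞ K X o
      ... | inʳ {X₁} m = begin
        Ro (K ⊞ X₁) ≤⟨ Ro-⊞-capped (acc rsK) (rsX [ left-option m ]) c (WT-left wX m) ⟩
        r + Ro X₁   ≤⟨ +-monoʳ-≤ r (left-Ro≤Lo m) ⟩
        r + Lo X    ∎
      ... | inˡ {K₁} m with Ro-attained (odd⇒node (WT-left even m))
      ...   | K₂ , m₂ , e = begin
        Ro (K₁ ⊞ X) ≤⟨ right-Ro≤Lo (∈-⊞⁺ rights-⊞ K₁ X (inˡ m₂)) ⟩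
        Lo (K₂ ⊞ X) ≤⟨ Lo-⊞-capped (rsK (right-option m₂ ∷ [ left-option m ])) (acc rsX) c₂ wX ⟩
        r + Lo X    ∎
        where
        Lo₂≤r : Lo K₂ ≤ r
        Lo₂≤r = begin
          Lo K₂ ≡⟨ e ⟩
          Ro K₁ ≤⟨ left-Ro≤Lo m ⟩
          Lo K  ≤⟨ Lo≤ ⟩
          r     ∎
        c₂ : Capped r K₂
        c₂ = capped-reply c m m₂ Lo₂≤r

  Lf-⊞-capped : ∀ {K q X} → Capped r K → WT q X → Lf q (K ⊞ X) ≤ r + Lf q X
  Lf-⊞-capped {K} {ev} {X} c wX = Ro-⊞-capped (⊏-acc K) (⊏-acc X) c wX
  Lf-⊞-capped {K} {od} {X} c wX = Lo-⊞-capped (⊏-acc K) (⊏-acc X) c wX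

module _ {r : ℤ} where
  open ≤-Reasoning

  mutual
    Ro-⊞-≥ : ∀ {K X} → Acc _⊏_ K → Acc _⊏_ X → WT ev K → r ≤ Ro K → WT ev X
           → r + Ro X ≤ Ro (K ⊞ X)
    Ro-⊞-≥ {K} {int x} _ _ _ r≤ _ = begin
      r + x          ≤⟨ +-monoˡ-≤ x r≤ ⟩
      Ro K + x       ≡⟨ Ro-⊞-int K x ⟨
      Ro (K ⊞ int x) ∎
    Ro-⊞-≥ {K} {X@(node _ _)} (acc rsK) (acc rsX) wK r≤ wX = Ro-greatest (⊞-nodeʳ K is-node) bound
      where
      bound : ∀ {O} → O ∈ rights (K ⊞ X) → r + Ro X ≤ Lo O
      bound o with ∈-⊞⁻ rights-⊞ K X o
      ... | inʳ {X₁} m = begin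
        r + Ro X    ≤⟨ +-monoʳ-≤ r (right-Ro≤Lo {X} m) ⟩
        r + Lo X₁   ≤⟨ Lo-⊞-≥ (acc rsK) (rsX [ right-option m ]) wK r≤ (WT-right wX m) ⟩
        Lo (K ⊞ X₁) ∎
      ... | inˡ {K₁} m with Lo-attained (odd⇒node (WT-right wK m))
      ...   | K₂ , m₂ , e = begin
        r + Ro X    ≤⟨ Ro-⊞-≥ (rsK (left-option m₂ ∷ [ right-option m ])) (acc rsX) wK₂ r≤Ro₂ wX ⟩
        Ro (K₂ ⊞ X) ≤⟨ left-Ro≤Lo (∈-⊞⁺ lefts-⊞ K₁ X (inˡ m₂)) ⟩
        Lo (K₁ ⊞ X) ∎
        where
        wK₂ : WT ev K₂
        wK₂ = WT-left (WT-right wK m) m₂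
        r≤Ro₂ : r ≤ Ro K₂
        r≤Ro₂ = begin
          r     ≤⟨ r≤ ⟩
          Ro K  ≤⟨ right-Ro≤Lo m ⟩
          Lo K₁ ≡⟨ e ⟨
          Ro K₂ ∎

    Lo-⊞-≥ : ∀ {K X} → Acc _⊏_ K → Acc _⊏_ X → WT ev K → r ≤ Ro K → WT od X
           → r + Lo X ≤ Lo (K ⊞ X)
    Lo-⊞-≥ {K} {X} accK (acc rsX) wK r≤ wX with Lo-attained (odd⇒node wX)
    ... | X₁ , m , e = begin
      r + Lo X    ≡⟨ cong (r +_) e ⟨
      r + Ro X₁   ≤⟨ Ro-⊞-≥ accK (rsX [ left-option m ]) wK r≤ (WT-left wX m) ⟩
      Ro (K ⊞ X₁) ≤⟨ left-Ro≤Lo (∈-⊞⁺ lefts-⊞ K X (inʳ m)) ⟩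
      Lo (K ⊞ X)  ∎

  Lf-⊞-≥ : ∀ {K q X} → WT ev K → r ≤ Ro K → WT q X → r + Lf q X ≤ Lf q (K ⊞ X)
  Lf-⊞-≥ {K} {ev} {X} wK r≤ wX = Ro-⊞-≥ (⊏-acc K) (⊏-acc X) wK r≤ wX
  Lf-⊞-≥ {K} {od} {X} wK r≤ wX = Lo-⊞-≥ (⊏-acc K) (⊏-acc X) wK r≤ wX

-- Bounds on Rf(K + X)

module _ {l : ℤ} where
  open ≤-Reasoning

  mutual
    Lo-⊞-floored : ∀ {K X} → Acc _⊏_ K → Acc _⊏_ X → Floored l K → WT ev X → l + Lo X ≤ Lo (K ⊞ X)
    Lo-⊞-floored {K} {int x} _ _ f _ = begin
      l + x          ≤⟨ +-monoˡ-≤ x (Floored.≤Lo f) ⟩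
      Lo K + x       ≡⟨ Lo-⊞-int K x ⟨
      Lo (K ⊞ int x) ∎
    Lo-⊞-floored {K} {X@(node _ _)} accK (acc rsX) f wX with Lo-attained {X} is-node
    ... | X₁ , m , e = begin
      l + Lo X    ≡⟨ cong (l +_) e ⟨
      l + Ro X₁   ≤⟨ Ro-⊞-floored accK (rsX [ left-option m ]) f (WT-left wX m) ⟩
      Ro (K ⊞ X₁) ≤⟨ left-Ro≤Lo (∈-⊞⁺ lefts-⊞ K X (inʳ m)) ⟩
      Lo (K ⊞ X)  ∎

    Ro-⊞-floored : ∀ {K X} → Acc _⊏_ K → Acc _⊏_ X → Floored l K → WT od X → l + Ro X ≤ Ro (K ⊞ X)
    Ro-⊞-floored {K} {X} (acc rsK) (acc rsX) f wX = Ro-greatest (⊞-nodeʳ K (odd⇒node wX)) bound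
      where
      open Floored f
      bound : ∀ {O} → O ∈ rights (K ⊞ X) → l + Ro X ≤ Lo O
      bound o with ∈-⊞⁻ rights-⊞ K X o
      ... | inʳ {X₁} m = begin
        l + Ro X    ≤⟨ +-monoʳ-≤ l (right-Ro≤Lo m) ⟩
        l + Lo X₁   ≤⟨ Lo-⊞-floored (acc rsK) (rsX [ right-option m ]) f (WT-right wX m) ⟩
        Lo (K ⊞ X₁) ∎
      ... | inˡ {K₁} m with Lo-attained (odd⇒node (WT-right even m))
      ...   | K₂ , m₂ , e = begin
        l + Ro X    ≤⟨ Ro-⊞-floored (rsK (left-option m₂ ∷ [ right-option m ])) (acc rsX) f₂ wX ⟩
        Ro (K₂ ⊞ X) ≤⟨ left-Ro≤Lo (∈-⊞⁺ lefts-⊞ K₁ X (inˡ m₂)) ⟩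
        Lo (K₁ ⊞ X) ∎
        where
        l≤Ro₂ : l ≤ Ro K₂
        l≤Ro₂ = begin
          l     ≤⟨ ≤Ro ⟩
          Ro K  ≤⟨ right-Ro≤Lo m ⟩
          Lo K₁ ≡⟨ e ⟨
          Ro K₂ ∎
        f₂ : Floored l K₂
        f₂ = floored-reply f m m₂ l≤Ro₂

  Rf-⊞-floored : ∀ {K q X} → Floored l K → WT q X → l + Rf q X ≤ Rf q (K ⊞ X)
  Rf-⊞-floored {K} {ev} {X} f wX = Lo-⊞-floored (⊏-acc K) (⊏-acc X) f wX
  Rf-⊞-floored {K} {od} {X} f wX = Ro-⊞-floored (⊏-acc K) (⊏-acc X) f wX

module _ {l : ℤ} where
  open ≤-Reasoning

  mutual
    Lo-⊞-≤ : ∀ {K X} → Acc _⊏_ K → Acc _⊏_ X → WT ev K → Lo K ≤ l → WT ev X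
           → Lo (K ⊞ X) ≤ l + Lo X
    Lo-⊞-≤ {K} {int x} _ _ _ ≤l _ = begin
      Lo (K ⊞ int x) ≡⟨ Lo-⊞-int K x ⟩
      Lo K + x       ≤⟨ +-monoˡ-≤ x ≤l ⟩
      l + x          ∎
    Lo-⊞-≤ {K} {X@(node _ _)} (acc rsK) (acc rsX) wK ≤l wX = Lo-least (⊞-nodeʳ K is-node) bound
      where
      bound : ∀ {O} → O ∈ lefts (K ⊞ X) → Ro O ≤ l + Lo X
      bound o with ∈-⊞⁻ lefts-⊞ K X o
      ... | inʳ {X₁} m = begin
        Ro (K ⊞ X₁) ≤⟨ Ro-⊞-≤ (acc rsK) (rsX [ left-option m ]) wK ≤l (WT-left wX m) ⟩
        l + Ro X₁   ≤⟨ +-monoʳ-≤ l (left-Ro≤Lo {X} m) ⟩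
        l + Lo X    ∎
      ... | inˡ {K₁} m with Ro-attained (odd⇒node (WT-left wK m))
      ...   | K₂ , m₂ , e = begin
        Ro (K₁ ⊞ X) ≤⟨ right-Ro≤Lo (∈-⊞⁺ rights-⊞ K₁ X (inˡ m₂)) ⟩
        Lo (K₂ ⊞ X) ≤⟨ Lo-⊞-≤ (rsK (right-option m₂ ∷ [ left-option m ])) (acc rsX) wK₂ Lo₂≤l wX ⟩
        l + Lo X    ∎
        where
        wK₂ : WT ev K₂
        wK₂ = WT-right (WT-left wK m) m₂
        Lo₂≤l : Lo K₂ ≤ l
        Lo₂≤l = begin
          Lo K₂ ≡⟨ e ⟩
          Ro K₁ ≤⟨ left-Ro≤Lo m ⟩
          Lo K  ≤⟨ ≤l ⟩
          l     ∎

    Ro-⊞-≤ : ∀ {K X} → Acc _⊏_ K → Acc _⊏_ X → WT ev K → Lo K ≤ l → WT od X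
           → Ro (K ⊞ X) ≤ l + Ro X
    Ro-⊞-≤ {K} {X} accK (acc rsX) wK ≤l wX with Ro-attained (odd⇒node wX)
    ... | X₁ , m , e = begin
      Ro (K ⊞ X)  ≤⟨ right-Ro≤Lo (∈-⊞⁺ rights-⊞ K X (inʳ m)) ⟩
      Lo (K ⊞ X₁) ≤⟨ Lo-⊞-≤ accK (rsX [ right-option m ]) wK ≤l (WT-right wX m) ⟩
      l + Lo X₁   ≡⟨ cong (l +_) e ⟩
      l + Ro X    ∎

  Rf-⊞-≤ : ∀ {K q X} → WT ev K → Lo K ≤ l → WT q X → Rf q (K ⊞ X) ≤ l + Rf q X
  Rf-⊞-≤ {K} {ev} {X} wK ≤l wX = Lo-⊞-≤ (⊏-acc K) (⊏-acc X) wK ≤l wX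
  Rf-⊞-≤ {K} {od} {X} wK ≤l wX = Ro-⊞-≤ (⊏-acc K) (⊏-acc X) wK ≤l wX

Lf-⊞≡Ro+Lf : ∀ {K q X} → WT ev K → Lo K ≤ Ro K → OptionGaps≤0 K → WT q X
           → Lf q (K ⊞ X) ≡ Ro K + Lf q X
Lf-⊞≡Ro+Lf wK Lo≤Ro gaps wX = ≤-antisym
  (Lf-⊞-capped (record { even = wK ; Lo≤ = Lo≤Ro ; Ro≤ = ≤-refl ; gaps = gaps }) wX)
  (Lf-⊞-≥ wK ≤-refl wX)

Rf-⊞≡Lo+Rf : ∀ {K q X} → WT ev K → Lo K ≤ Ro K → OptionGaps≤0 K → WT q X
           → Rf q (K ⊞ X) ≡ Lo K + Rf q X
Rf-⊞≡Lo+Rf wK Lo≤Ro gaps wX = ≤-antisym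
  (Rf-⊞-≤ wK ≤-refl wX)
  (Rf-⊞-floored (record { even = wK ; ≤Lo = ≤-refl ; ≤Ro = Lo≤Ro ; gaps = gaps }) wX)

int-gaps : ∀ {n} → OptionGaps≤0 (int n)
int-gaps ()

mainTheorem19 : (G : Game) → WT ev G → (∀ K → Option K G → InI K) → Lo G ≤ Ro G
                → (G ≈₊ int (Ro G)) × (G ≈₋ int (Lo G))
mainTheorem19 G wG optionsInI Lo≤Ro =
  (ev , wG , wt-int , λ q X wX →
    trans (Lf-⊞≡Ro+Lf wG Lo≤Ro gaps wX) (sym (Lf-⊞≡Ro+Lf wt-int ≤-refl int-gaps wX))) ,
  (ev , wG , wt-int , λ q X wX →
    trans (Rf-⊞≡Lo+Rf wG Lo≤Ro gaps wX) (sym (Rf-⊞≡Lo+Rf wt-int ≤-refl int-gaps wX)))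
  where
  gaps : OptionGaps≤0 G
  gaps o s wS = i-j≤0⇒i≤j (proj₁ (optionsInI _ o) _ s wS)
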